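{- Let $K$ be a field and $f\in K[x]$ with $\deg(f)=d\geq 2$. Let $\alpha_1,\alpha_2$ be distinct roots of $f$ (in $\overline{K}$). Suppose that $T_{\alpha_1}(f)$ is repeating. Then $T_{\alpha_2}(f)$ is not repeating. Moreover, $0$ is a periodic point of $f$, $0\in T_{\alpha_1}(f)$, and $0\notin T_{\alpha_2}(f)$.
   Context: $f^n$ denotes the $n$-th iterate of $f$ ($f^0=x$). For $\alpha\in\overline{K}$ and $n\geq 0$, $R_{n,\alpha}(f)=\{\beta\in\overline{K}: f^n(\beta)=\alpha\}$. The $f$-preimage tree of $\alpha$ is $T_\alpha(f)=\bigsqcup_{i\geq 0}R_{i,\alpha}(f)$ (disjoint union), with an edge between $\beta\in R_{i+1,\alpha}(f)$ and $\theta\in R_{i,\alpha}(f)$ iff $f(\beta)=\theta$; "$0\in T_\alpha(f)$" means $0\in R_{i,\alpha}(f)$ for some $i\geq 0$. $T_\alpha(f)$ is called repeating if there are distinct nonnegative integers $n,m$ with $R_{n,\alpha}(f)\cap R_{m,\alpha}(f)\neq\emptyset$. A point $z$ is periodic if $f^n(z)=z$ for some $n\geq 1$. -}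

module Defs where

open import Level using (Level; _⊔_)
open import Data.Nat using (ℕ; zero; suc)
open import Data.List using (List; []; _∷_; _++_; length; foldr; map)
open import Data.Product using (Σ; ∃; ∃₂; _×_; _,_)
open import Relation.Nullary using (¬_)
open import Relation.Binary.PropositionalEquality using (_≡_)
open import Algebra.Bundles using (CommutativeRing; RawRing)
open import Algebra.Morphism.Structures using (module RingMorphisms)

private
  variable
    c ℓ c' ℓ' : Level

record IsField (R : CommutativeRing c ℓ) : Set (c ⊔ ℓ) where
  open CommutativeRing R
  field
    1≉0     : ¬ (1# ≈ 0#)
    inverse : ∀ x → ¬ (x ≈ 0#) → ∃ λ y → x * y ≈ 1#

-- Polynomials over a ring: coefficient lists, lowest degree first.
Poly : CommutativeRing c ℓ → Set c
Poly R = List (CommutativeRing.Carrier R)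

eval : (R : CommutativeRing c ℓ) → Poly R → CommutativeRing.Carrier R → CommutativeRing.Carrier R
eval R p x = foldr (λ a acc → a + x * acc) 0# p
  where open CommutativeRing R

HasDegree : (R : CommutativeRing c ℓ) → Poly R → ℕ → Set (c ⊔ ℓ)
HasDegree R p d =
  ∃₂ λ (cs : List Carrier) (a : Carrier) →
    (length cs ≡ d) × (¬ (a ≈ 0#)) × (p ≡ cs ++ (a ∷ []))
  where open CommutativeRing R

IsAlgClosed : CommutativeRing c ℓ → Set (c ⊔ ℓ)
IsAlgClosed R = ∀ (p : Poly R) (d : ℕ) → HasDegree R p (suc d) →
  ∃ λ x → CommutativeRing._≈_ R (eval R p x) (CommutativeRing.0# R)

record IsAlgebraicClosure (K : CommutativeRing c ℓ) (L : CommutativeRing c' ℓ')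
         (ι : CommutativeRing.Carrier K → CommutativeRing.Carrier L) : Set (c ⊔ ℓ ⊔ c' ⊔ ℓ') where
  field
    isField     : IsField L
    isHom       : RingMorphisms.IsRingHomomorphism (CommutativeRing.rawRing K) (CommutativeRing.rawRing L) ι
    algClosed   : IsAlgClosed L
    algebraic   : ∀ (y : CommutativeRing.Carrier L) → ∃₂ λ (p : Poly K) (d : ℕ) →
                    HasDegree K p d × CommutativeRing._≈_ L (eval L (map ι p) y) (CommutativeRing.0# L)

iter : ∀ {a} {A : Set a} → (A → A) → ℕ → A → A
iter f zero    x = x
iter f (suc n) x = f (iter f n x)

module Dynamics (L : CommutativeRing c' ℓ') where
  open CommutativeRing L

  _∈R[_,_]_ : Carrier → ℕ → Carrier → (Carrier → Carrier) → Set ℓ'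
  β ∈R[ n , α ] g = iter g n β ≈ α

  Repeating : (Carrier → Carrier) → Carrier → Set (c' ⊔ ℓ')
  Repeating g α = ∃₂ λ (n m : ℕ) → ¬ (n ≡ m) × ∃ λ β → (β ∈R[ n , α ] g) × (β ∈R[ m , α ] g)

  ZeroInTree : (Carrier → Carrier) → Carrier → Set ℓ'
  ZeroInTree g α = ∃ λ i → 0# ∈R[ i , α ] g

  Periodic : (Carrier → Carrier) → Carrier → Set ℓ'
  Periodic g z = ∃ λ n → iter g (suc n) z ≈ z

{-# OPTIONS --safe #-}
-- If two preimages β ∈ R_{n,α}, β ∈ R_{n+k+1,α} share a point, then f^{k+1}(α) = α, so a
-- repeating tree has a periodic root. Since f(α₁) = 0, the point 0 lies on the cycle of α₁,
-- and α₁ = f^p(0) is the unique point of that cycle mapping to 0. Any root α₂ in the orbit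
-- of 0 would be another point of the cycle mapping to 0, hence equal to α₁; a repeating
-- T_{α₂} would put α₂ in the orbit of 0 by the same argument.
module Submission where

open import Defs
open import Level using (Level)
open import Data.Nat using (ℕ; zero; suc; _+_; _*_; _≤_; _<_)
open import Data.Nat.Properties using (+-comm; <-cmp; m≤n⇒∃[o]m+o≡n)
open import Data.Nat.Solver using (module +-*-Solver)
open import Data.Product using (_×_; _,_; ∃)
open import Data.List using ([]; _∷_; map)
open import Data.Empty using (⊥-elim)
open import Relation.Nullary using (¬_)
open import Relation.Binary using (Setoid; _Preserves_⟶_; tri<; tri≈; tri>)
open import Relation.Binary.PropositionalEquality as ≡ using (_≡_)
open import Algebra.Bundles using (CommutativeRing)

iter-+ : ∀ {a} {A : Set a} (g : A → A) m n x → iter g (m + n) x ≡ iter g m (iter g n x)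
iter-+ g zero    n x = ≡.refl
iter-+ g (suc m) n x = ≡.cong g (iter-+ g m n x)

iter-commute : ∀ {a} {A : Set a} (g : A → A) n x → iter g n (g x) ≡ g (iter g n x)
iter-commute g zero    x = ≡.refl
iter-commute g (suc n) x = ≡.cong g (iter-commute g n x)

a+b*[1+a]≡b+a*[1+b] : ∀ a b → a + b * suc a ≡ b + a * suc b
a+b*[1+a]≡b+a*[1+b] = solve 2 (λ a b → a :+ b :* (con 1 :+ a) := b :+ a :* (con 1 :+ b)) ≡.refl
  where open +-*-Solver

module IterationOnSetoid {c ℓ} (S : Setoid c ℓ) (g : Setoid.Carrier S → Setoid.Carrier S)
  (g-cong : g Preserves Setoid._≈_ S ⟶ Setoid._≈_ S) where

  open Setoid S
  open import Relation.Binary.Reasoning.Setoid S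

  iter-cong : ∀ n {x y} → x ≈ y → iter g n x ≈ iter g n y
  iter-cong zero    x≈y = x≈y
  iter-cong (suc n) x≈y = g-cong (iter-cong n x≈y)

  iter-*-period : ∀ {p z} → iter g (suc p) z ≈ z → ∀ k → iter g (k * suc p) z ≈ z
  iter-*-period         z-per zero    = refl
  iter-*-period {p} {z} z-per (suc k) = begin
    iter g (suc p + k * suc p) z           ≡⟨ iter-+ g (suc p) (k * suc p) z ⟩
    iter g (suc p) (iter g (k * suc p) z)  ≈⟨ iter-cong (suc p) (iter-*-period z-per k) ⟩
    iter g (suc p) z                       ≈⟨ z-per ⟩
    z                                      ∎

  iter-+-*-period : ∀ {p z} → iter g (suc p) z ≈ z → ∀ n k → iter g (n + k * suc p) z ≈ iter g n z
  iter-+-*-period {p} {z} z-per n k =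
    trans (reflexive (iter-+ g n (k * suc p) z)) (iter-cong n (iter-*-period z-per k))

  cycle-predecessor-unique : ∀ {a b z} → iter g (suc a) z ≈ z → iter g (suc b) z ≈ z →
                             iter g a z ≈ iter g b z
  cycle-predecessor-unique {a} {b} {z} a-per b-per = begin
    iter g a z                ≈⟨ sym (iter-+-*-period a-per a b) ⟩
    iter g (a + b * suc a) z  ≡⟨ ≡.cong (λ n → iter g n z) (a+b*[1+a]≡b+a*[1+b] a b) ⟩
    iter g (b + a * suc b) z  ≈⟨ iter-+-*-period b-per b a ⟩
    iter g b z                ∎

  common-preimage⇒periodic : ∀ {n m β α} → n < m → iter g n β ≈ α → iter g m β ≈ α →
                             ∃ λ k → iter g (suc k) α ≈ α
  common-preimage⇒periodic {n} {β = β} {α} n<m n↦α m↦α with m≤n⇒∃[o]m+o≡n n<m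
  ... | k , ≡.refl = k , (begin
    iter g (suc k) α              ≈⟨ iter-cong (suc k) (sym n↦α) ⟩
    iter g (suc k) (iter g n β)   ≡⟨ iter-+ g (suc k) n β ⟨
    iter g (suc k + n) β          ≡⟨ ≡.cong (λ m → iter g (suc m) β) (+-comm k n) ⟩
    iter g (suc n + k) β          ≈⟨ m↦α ⟩
    α                             ∎)

  cycle-preimage : ∀ p {α z} → g α ≈ z → iter g (suc p) α ≈ α → iter g p z ≈ α
  cycle-preimage p {α} gα≈z α-per =
    trans (iter-cong p (sym gα≈z)) (trans (reflexive (iter-commute g p α)) α-per)

  cycle-preimage-periodic : ∀ p {α z} → g α ≈ z → iter g (suc p) α ≈ α → iter g (suc p) z ≈ z
  cycle-preimage-periodic p gα≈z α-per = trans (g-cong (cycle-preimage p gα≈z α-per)) gα≈z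

  -- z has periods p+1 and j+1, with predecessors α₁ and α₂ respectively.
  orbit-preimage-unique : ∀ p j {α₁ α₂ z} → g α₁ ≈ z → g α₂ ≈ z → iter g (suc p) α₁ ≈ α₁ →
                          iter g j z ≈ α₂ → α₁ ≈ α₂
  orbit-preimage-unique p j gα₁≈z gα₂≈z α₁-per j↦α₂ =
    trans (sym (cycle-preimage p gα₁≈z α₁-per))
      (trans (cycle-predecessor-unique {p} {j} (cycle-preimage-periodic p gα₁≈z α₁-per)
                                               (trans (g-cong j↦α₂) gα₂≈z))
             j↦α₂)

module PreimageTrees {c ℓ} (L : CommutativeRing c ℓ)
  (g : CommutativeRing.Carrier L → CommutativeRing.Carrier L)
  (g-cong : g Preserves CommutativeRing._≈_ L ⟶ CommutativeRing._≈_ L) where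

  open CommutativeRing L using (_≈_; setoid; 0#)

  open Dynamics L
  open IterationOnSetoid setoid g g-cong

  repeating⇒periodic : ∀ {α} → Repeating g α → Periodic g α
  repeating⇒periodic (n , m , n≢m , β , n↦α , m↦α) with <-cmp n m
  ... | tri< n<m _ _ = common-preimage⇒periodic n<m n↦α m↦α
  ... | tri≈ _ n≡m _ = ⊥-elim (n≢m n≡m)
  ... | tri> _ _ m<n = common-preimage⇒periodic m<n m↦α n↦α

  periodic-root⇒zero-periodic : ∀ {α} → Periodic g α → g α ≈ 0# → Periodic g 0#
  periodic-root⇒zero-periodic (p , α-per) gα≈0 = p , cycle-preimage-periodic p gα≈0 α-per

  periodic-root⇒zero-in-tree : ∀ {α} → Periodic g α → g α ≈ 0# → ZeroInTree g α
  periodic-root⇒zero-in-tree (p , α-per) gα≈0 = p , cycle-preimage p gα≈0 α-per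

  zero-in-tree-of-periodic-root-only : ∀ {α₁ α₂} → Periodic g α₁ → g α₁ ≈ 0# → g α₂ ≈ 0# →
                                       ZeroInTree g α₂ → α₁ ≈ α₂
  zero-in-tree-of-periodic-root-only (p , α₁-per) gα₁≈0 gα₂≈0 (j , j↦α₂) =
    orbit-preimage-unique p j gα₁≈0 gα₂≈0 α₁-per j↦α₂

eval-cong : ∀ {c ℓ} (R : CommutativeRing c ℓ) (p : Poly R) →
            eval R p Preserves CommutativeRing._≈_ R ⟶ CommutativeRing._≈_ R
eval-cong R []      x≈y = CommutativeRing.refl R
eval-cong R (a ∷ p) x≈y = +-cong refl (*-cong x≈y (eval-cong R p x≈y))
  where open CommutativeRing R using (refl; +-cong; *-cong)

lemma2p2 : ∀ {c ℓ c' ℓ' : Level}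
    (K : CommutativeRing c ℓ) → IsField K →
    (Kbar : CommutativeRing c' ℓ') (ι : CommutativeRing.Carrier K → CommutativeRing.Carrier Kbar) →
    IsAlgebraicClosure K Kbar ι →
    (f : Poly K) (d : ℕ) → HasDegree K f d → 2 ≤ d →
    (α₁ α₂ : CommutativeRing.Carrier Kbar) →
    ¬ (CommutativeRing._≈_ Kbar α₁ α₂) →
    CommutativeRing._≈_ Kbar (eval Kbar (map ι f) α₁) (CommutativeRing.0# Kbar) →
    CommutativeRing._≈_ Kbar (eval Kbar (map ι f) α₂) (CommutativeRing.0# Kbar) →
    Dynamics.Repeating Kbar (eval Kbar (map ι f)) α₁ →
    ¬ Dynamics.Repeating Kbar (eval Kbar (map ι f)) α₂
      × Dynamics.Periodic Kbar (eval Kbar (map ι f)) (CommutativeRing.0# Kbar)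
      × Dynamics.ZeroInTree Kbar (eval Kbar (map ι f)) α₁
      × ¬ Dynamics.ZeroInTree Kbar (eval Kbar (map ι f)) α₂
lemma2p2 K _ Kbar ι _ f _ _ _ α₁ α₂ α₁≉α₂ fα₁≈0 fα₂≈0 rep₁ =
  ¬rep₂ , periodic-root⇒zero-periodic α₁-per fα₁≈0 , periodic-root⇒zero-in-tree α₁-per fα₁≈0 , zero∉T₂
  where
  open Dynamics Kbar
  F : CommutativeRing.Carrier Kbar → CommutativeRing.Carrier Kbar
  F = eval Kbar (map ι f)
  open PreimageTrees Kbar F (eval-cong Kbar (map ι f))

  α₁-per : Periodic F α₁
  α₁-per = repeating⇒periodic rep₁

  zero∉T₂ : ¬ ZeroInTree F α₂
  zero∉T₂ zero∈T₂ = α₁≉α₂ (zero-in-tree-of-periodic-root-only α₁-per fα₁≈0 fα₂≈0 zero∈T₂)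

  ¬rep₂ : ¬ Repeating F α₂
  ¬rep₂ rep₂ = zero∉T₂ (periodic-root⇒zero-in-tree (repeating⇒periodic rep₂) fα₂≈0)
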